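{- Let $q\ge 3$ (even or odd) and let $\mathbf f\in A_q^+$ be a forbidden factor whose last symbol is $q-1$. Then $\mathbf f$ does not induce zero periodicity on $A_q^\infty$ if and only if $\mathbf f\in W_q$.
   Context: $A_q=\{0,1,\dots,q-1\}$. $A_q^*$ (resp. $A_q^+$) is the set of all (resp. nonempty) finite words over $A_q$, $A_q^\infty$ the set of right-infinite words; $\mathbf a^i$ is $i$-fold concatenation, $\mathbf a^\infty=\mathbf a\mathbf a\cdots$. For a set $X$ of words, $X(\mathbf f)$ is the set of words of $X$ not containing $\mathbf f$ as a factor (contiguous subword), and $\mathbf p|X$ the words of $X$ with prefix $\mathbf p$. An infinite word has ultimate period $\mathbf c\ne\epsilon$ if it equals $\mathbf b\mathbf c^\infty$ for a finite word $\mathbf b$. For distinct words $\mathbf s,\mathbf t$ of the same (finite or infinite) length, let $k$ be the leftmost differing position, $u=\sum_{i<k}s_i$, $v$ the number of nonzero symbols among $s_1,\dots,s_{k-1}$. $\mathbf s\prec\mathbf t$ iff ($u$ even and $s_k<t_k$) or ($u$ odd and $s_k>t_k$); $\mathbf s\triangleleft\mathbf t$ iff ($u+v$ even and $s_k<t_k$) or ($u+v$ odd and $s_k>t_k$). The appropriate order is $\prec$ for even $q$ and $\triangleleft$ for odd $q$; first/last mean least/greatest in it. $\mathbf f$ induces zero periodicity on $A_q^\infty$ if for every $\mathbf p\in A_q^*(\mathbf f)$ the first and last words of $\mathbf p|A_q^\infty(\mathbf f)$ both have ultimate period $0$. $W_q=\{(q-2)^\ell(q-1):\ell\ge 0\}$.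 -}

module Defs where

open import Data.Nat using (ℕ; zero; suc; _+_; _∸_; _<_; _≤_; _%_; _>_)
open import Data.Fin using (Fin; toℕ)
open import Data.List using (List; []; _∷_; _++_; map; replicate; length; tabulate; [_])
open import Data.Product using (Σ; ∃; _×_; _,_)
open import Data.Sum using (_⊎_)
open import Data.Bool using (Bool; true; false; if_then_else_)
open import Relation.Nullary using (¬_)
open import Relation.Binary.PropositionalEquality using (_≡_; _≢_)

-- Finite words over A_q are lists of Fin q; infinite words are functions ℕ → Fin q
-- (positions are 0-indexed here).
Word : ℕ → Set
Word q = List (Fin q)

InfWord : ℕ → Set
InfWord q = ℕ → Fin q

pref : ∀ {q} → ℕ → InfWord q → Word q
pref n x = tabulate {n = n} (λ j → x (toℕ j))

shift : ∀ {q} → ℕ → InfWord q → InfWord q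
shift i x n = x (i + n)

FactorOf : ∀ {q} → Word q → Word q → Set
FactorOf f p = ∃ λ a → ∃ λ b → p ≡ a ++ (f ++ b)

FactorOfInf : ∀ {q} → Word q → InfWord q → Set
FactorOfInf f x = ∃ λ i → pref (length f) (shift i x) ≡ f

PrefixOf : ∀ {q} → Word q → InfWord q → Set
PrefixOf p x = pref (length p) x ≡ p

InPF : ∀ {q} → Word q → Word q → InfWord q → Set
InPF f p x = PrefixOf p x × ¬ FactorOfInf f x



-- x = b 0^∞ for some finite word b (ultimate period 0): from some position N on,
-- every letter of x is the symbol 0 (b is then the prefix of length N).
HasUltPeriod0 : ∀ {q} → InfWord q → Set
HasUltPeriod0 x = ∃ λ (N : ℕ) → ∀ n → N ≤ n → toℕ (x n) ≡ 0

sumBefore : ∀ {q} → InfWord q → ℕ → ℕ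
sumBefore s zero = 0
sumBefore s (suc k) = sumBefore s k + toℕ (s k)

nonzeroBefore : ∀ {q} → InfWord q → ℕ → ℕ
nonzeroBefore s zero = 0
nonzeroBefore s (suc k) with toℕ (s k)
... | zero = nonzeroBefore s k
... | suc _ = suc (nonzeroBefore s k)

FirstDiff : ∀ {q} → InfWord q → InfWord q → ℕ → Set
FirstDiff s t k = (∀ i → i < k → s i ≡ t i) × (s k ≢ t k)

CmpAt : ∀ {q} → ℕ → InfWord q → InfWord q → ℕ → Set
CmpAt w s t k = (w % 2 ≡ 0 × toℕ (s k) < toℕ (t k)) ⊎ (w % 2 ≡ 1 × toℕ (s k) > toℕ (t k))

_≺_ : ∀ {q} → InfWord q → InfWord q → Set
s ≺ t = ∃ λ k → FirstDiff s t k × CmpAt (sumBefore s k) s t k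

_◁_ : ∀ {q} → InfWord q → InfWord q → Set
s ◁ t = ∃ λ k → FirstDiff s t k × CmpAt (sumBefore s k + nonzeroBefore s k) s t k

isEven : ℕ → Bool
isEven zero = true
isEven (suc zero) = false
isEven (suc (suc n)) = isEven n

AppLt : (q : ℕ) → InfWord q → InfWord q → Set
AppLt q s t = if isEven q then s ≺ t else s ◁ t

IsFirst : (q : ℕ) → Word q → Word q → InfWord q → Set
IsFirst q f p x = InPF f p x × (∀ y → InPF f p y → ¬ AppLt q y x)

IsLast : (q : ℕ) → Word q → Word q → InfWord q → Set
IsLast q f p x = InPF f p x × (∀ y → InPF f p y → ¬ AppLt q x y)

InducesZeroPeriodicity : (q : ℕ) → Word q → Set
InducesZeroPeriodicity q f =
  ∀ (p : Word q) → ¬ FactorOf f p →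
    (∀ x → IsFirst q f p x → HasUltPeriod0 x) × (∀ x → IsLast q f p x → HasUltPeriod0 x)

InW : (q : ℕ) → Word q → Set
InW q f = ∃ λ ℓ → map toℕ f ≡ replicate ℓ (q ∸ 2) ++ [ q ∸ 1 ]

LastIsTop : (q : ℕ) → Word q → Set
LastIsTop q f = ∃ λ (g : Word q) → ∃ λ (a : Fin q) → f ≡ g ++ [ a ] × toℕ a ≡ q ∸ 1

module Submission where

-- Both orders compare two words at their first difference k according to the parity
-- of an index (u for ≺, u + v for ◁) that grows letter by letter by a "weight".  In
-- the appropriate order for q the letters 0 and q-2 have even weight and q-1 has odd
-- weight, so reading 0 or q-2 keeps the parity of the index and reading q-1 flips it.
--
-- (⇒, contrapositively) Let f = g (q-1) ∉ W_q and let x be the first or last word of p | A_q^∞(f).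
-- Replacing the tail of x from a position n ≥ |p| by  c 0^∞  gives a competitor that
-- still avoids f unless c = q-1 completes an occurrence of f.  Comparing x with these
-- competitors shows x is greedy: in one parity state it takes the least admissible
-- letter (hence 0, and 0 keeps the state, so x ends in 0^∞), in the other the
-- greatest (hence q-2 or q-1).  A run of |g| letters q-2 in the greedy state would
-- make q-1 admissible, because f = (q-2)^|g| (q-1) is excluded; so q-1 is read, the
-- state flips, and x ends in 0^∞.
-- (⇐) For f = (q-2)^ℓ (q-1) the constant word (q-2)^∞ is the last word of
-- (q-2)^ℓ | A_q^∞(f), and it does not end in 0^∞.

open import Defs
open import Data.Nat using (ℕ; zero; suc; _+_; _∸_; _≤_; _<_; _%_; pred; z≤n; s≤s; _≟_)
open import Data.Nat.Properties
open import Algebra.Properties.CommutativeSemigroup +-commutativeSemigroup using (interchange)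
open import Data.Fin using (Fin; toℕ; fromℕ; inject₁) renaming (zero to fz)
open import Data.Fin.Properties using (toℕ-injective; toℕ<n; toℕ-fromℕ; toℕ-inject₁)
open import Data.List using (List; []; _∷_; _++_; map; replicate; length; [_])
open import Data.List.Properties using (≡-dec; ∷-injective; map-++; map-replicate; map-injective; length-++; length-map; length-replicate)
open import Data.List.Relation.Unary.All using (All; _∷_)
open import Data.List.Relation.Unary.All.Properties using (++⁻ˡ; ++⁻ʳ; replicate⁺)
open import Data.Product using (∃; _×_; _,_; proj₁; proj₂)
open import Data.Sum using (_⊎_; inj₁; inj₂)
open import Data.Bool using (Bool; true; false; not; if_then_else_)
open import Data.Empty using (⊥; ⊥-elim)
open import Data.Unit using (⊤; tt)
open import Function using (_∘_)
open import Relation.Nullary using (¬_; Dec; yes; no)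
open import Relation.Nullary.Decidable using (decidable-stable)
open import Relation.Binary using (Tri; tri<; tri≈; tri>)
open import Relation.Binary.PropositionalEquality hiding ([_])
open ≡-Reasoning

isEven-suc : ∀ n → isEven (suc n) ≡ not (isEven n)
isEven-suc zero = refl
isEven-suc (suc zero) = refl
isEven-suc (suc (suc n)) = isEven-suc n

isEven-+-even : ∀ m {n} → isEven n ≡ true → isEven (m + n) ≡ isEven m
isEven-+-even zero e = e
isEven-+-even (suc zero) {n} e = trans (isEven-suc n) (cong not e)
isEven-+-even (suc (suc m)) e = isEven-+-even m e

isEven-+-odd : ∀ m {n} → isEven n ≡ false → isEven (m + n) ≡ not (isEven m)
isEven-+-odd zero e = e
isEven-+-odd (suc zero) {n} e = trans (isEven-suc n) (cong not e)
isEven-+-odd (suc (suc m)) e = isEven-+-odd m e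

even⇒%2≡0 : ∀ n → isEven n ≡ true → n % 2 ≡ 0
even⇒%2≡0 zero e = refl
even⇒%2≡0 (suc (suc n)) e = even⇒%2≡0 n e

odd⇒%2≡1 : ∀ n → isEven n ≡ false → n % 2 ≡ 1
odd⇒%2≡1 (suc zero) e = refl
odd⇒%2≡1 (suc (suc n)) e = odd⇒%2≡1 n e

bool-cases : ∀ b w → b ≡ w ⊎ b ≡ not w
bool-cases true true = inj₁ refl
bool-cases true false = inj₂ refl
bool-cases false true = inj₂ refl
bool-cases false false = inj₁ refl

index : ∀ {q} → Bool → InfWord q → ℕ → ℕ
index true s k = sumBefore s k
index false s k = sumBefore s k + nonzeroBefore s k

nonzeroMark : ℕ → ℕ
nonzeroMark zero = 0
nonzeroMark (suc _) = 1

weight : Bool → ℕ → ℕ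
weight true d = d
weight false d = d + nonzeroMark d

nonzeroBefore-suc : ∀ {q} (s : InfWord q) k →
  nonzeroBefore s (suc k) ≡ nonzeroBefore s k + nonzeroMark (toℕ (s k))
nonzeroBefore-suc s k with toℕ (s k)
... | zero = sym (+-identityʳ _)
... | suc _ = +-comm 1 _

index-suc : ∀ {q} b (s : InfWord q) k → index b s (suc k) ≡ index b s k + weight b (toℕ (s k))
index-suc true s k = refl
index-suc false s k = begin
  (sumBefore s k + toℕ (s k)) + nonzeroBefore s (suc k)
    ≡⟨ cong (sumBefore s k + toℕ (s k) +_) (nonzeroBefore-suc s k) ⟩
  (sumBefore s k + toℕ (s k)) + (nonzeroBefore s k + nonzeroMark (toℕ (s k)))
    ≡⟨ interchange (sumBefore s k) (toℕ (s k)) (nonzeroBefore s k) (nonzeroMark (toℕ (s k))) ⟩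
  (sumBefore s k + nonzeroBefore s k) + weight false (toℕ (s k)) ∎

index-zero : ∀ {q} b (s : InfWord q) → index b s 0 ≡ 0
index-zero true s = refl
index-zero false s = refl

Agree : ∀ {A : Set} → (ℕ → A) → (ℕ → A) → ℕ → Set
Agree s t k = ∀ i → i < k → s i ≡ t i

index-agree : ∀ {q} b (s t : InfWord q) k → Agree s t k → index b s k ≡ index b t k
index-agree b s t zero _ = trans (index-zero b s) (sym (index-zero b t))
index-agree b s t (suc k) ag = begin
  index b s (suc k)                  ≡⟨ index-suc b s k ⟩
  index b s k + weight b (toℕ (s k)) ≡⟨ cong₂ (λ i c → i + weight b (toℕ c)) below (ag k (n<1+n k)) ⟩
  index b t k + weight b (toℕ (t k)) ≡⟨ index-suc b t k ⟨
  index b t (suc k)                  ∎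
  where
  below : index b s k ≡ index b t k
  below = index-agree b s t k (λ i i<k → ag i (m<n⇒m<1+n i<k))

parity : ∀ {q} → Bool → InfWord q → ℕ → Bool
parity b s k = isEven (index b s k)

parity-keep : ∀ {q} b (s : InfWord q) k → isEven (weight b (toℕ (s k))) ≡ true →
  parity b s (suc k) ≡ parity b s k
parity-keep b s k e = trans (cong isEven (index-suc b s k)) (isEven-+-even (index b s k) e)

parity-flip : ∀ {q} b (s : InfWord q) k → isEven (weight b (toℕ (s k))) ≡ false →
  parity b s (suc k) ≡ not (parity b s k)
parity-flip b s k e = trans (cong isEven (index-suc b s k)) (isEven-+-odd (index b s k) e)

-- In the appropriate order for q (flavour isEven q), the letter 0 has even weight ...
weight-zero : ∀ b → weight b 0 ≡ 0
weight-zero true = refl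
weight-zero false = refl

-- ... so does q-2 (here d, which has the parity of q) ...
weight-self : ∀ d → isEven (weight (isEven d) d) ≡ true
weight-self d = by-flavour (isEven d) d refl
  where
  by-flavour : ∀ b m → isEven m ≡ b → isEven (weight b m) ≡ true
  by-flavour true m e = e
  by-flavour false (suc m) e = trans (isEven-+-odd (suc m) refl) (cong not e)

-- ... and q-1 has odd weight.
weight-succ : ∀ d → isEven (weight (isEven d) (suc d)) ≡ false
weight-succ d = by-flavour (isEven d) refl
  where
  by-flavour : ∀ b → isEven d ≡ b → isEven (weight b (suc d)) ≡ false
  by-flavour true e = trans (isEven-suc d) (cong not e)
  by-flavour false e =
    trans (isEven-+-odd (suc d) refl) (cong not (trans (isEven-suc d) (cong not e)))

_⊏[_]_ : ∀ {q} → InfWord q → Bool → InfWord q → Set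
s ⊏[ b ] t = ∃ λ k → FirstDiff s t k × CmpAt (index b s k) s t k

toOrder : ∀ {q} b {s t : InfWord q} → (if b then s ≺ t else s ◁ t) → s ⊏[ b ] t
toOrder true lt = lt
toOrder false lt = lt

fromOrder : ∀ {q} b {s t : InfWord q} → s ⊏[ b ] t → if b then s ≺ t else s ◁ t
fromOrder true lt = lt
fromOrder false lt = lt

first-difference : ∀ {q} b (s t : InfWord q) k → Agree s t k → toℕ (s k) < toℕ (t k) →
  (parity b s k ≡ true → s ⊏[ b ] t) × (parity b s k ≡ false → t ⊏[ b ] s)
first-difference b s t k ag lt =
    (λ e → k , (ag , s≢t) , inj₁ (even⇒%2≡0 (index b s k) e , lt))
  , (λ e → k , ((λ i i<k → sym (ag i i<k)) , s≢t ∘ sym)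
           , inj₂ (odd⇒%2≡1 (index b t k) (trans (cong isEven (sym (index-agree b s t k ag))) e) , lt))
  where
  s≢t : s k ≢ t k
  s≢t e = <-irrefl (cong toℕ e) lt

Match : ∀ {A : Set} → List A → (ℕ → A) → Set
Match [] z = ⊤
Match (a ∷ u) z = z 0 ≡ a × Match u (λ n → z (suc n))

prefix⇒match : ∀ {q} (u : Word q) z → PrefixOf u z → Match u z
prefix⇒match [] z _ = tt
prefix⇒match (a ∷ u) z eq = proj₁ (∷-injective eq) , prefix⇒match u _ (proj₂ (∷-injective eq))

match⇒prefix : ∀ {q} (u : Word q) z → Match u z → PrefixOf u z
match⇒prefix [] z _ = refl
match⇒prefix (a ∷ u) z (e , m) = cong₂ _∷_ e (match⇒prefix u _ m)

match-agree : ∀ {A : Set} (u : List A) {z z'} → Agree z z' (length u) → Match u z → Match u z'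
match-agree [] ag _ = tt
match-agree (a ∷ u) ag (e , m) =
  trans (sym (ag 0 (s≤s z≤n))) e , match-agree u (λ j j<u → ag (suc j) (s≤s j<u)) m

match-unique : ∀ {A : Set} (u v : List A) {z} → Match u z → Match v z → length u ≡ length v → u ≡ v
match-unique [] [] _ _ _ = refl
match-unique (a ∷ u) (b ∷ v) (ea , mu) (eb , mv) len =
  cong₂ _∷_ (trans (sym ea) eb) (match-unique u v mu mv (cong pred len))

match-replicate⁺ : ∀ {A : Set} ℓ (c : A) {z} → (∀ j → j < ℓ → z j ≡ c) → Match (replicate ℓ c) z
match-replicate⁺ zero c h = tt
match-replicate⁺ (suc ℓ) c h = h 0 (s≤s z≤n) , match-replicate⁺ ℓ c (λ j j<ℓ → h (suc j) (s≤s j<ℓ))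

match-replicate⁻ : ∀ {A : Set} ℓ (c : A) {z} → Match (replicate ℓ c) z → ∀ j → j < ℓ → z j ≡ c
match-replicate⁻ (suc ℓ) c (e , m) zero _ = e
match-replicate⁻ (suc ℓ) c (e , m) (suc j) (s≤s j<ℓ) = match-replicate⁻ ℓ c m j j<ℓ

match-snoc⁺ : ∀ {A : Set} (u : List A) {a z} → Match u z → z (length u) ≡ a → Match (u ++ [ a ]) z
match-snoc⁺ [] _ e = e , tt
match-snoc⁺ (b ∷ u) (e , m) e' = e , match-snoc⁺ u m e'

match-snoc⁻ : ∀ {A : Set} (u : List A) {a z} → Match (u ++ [ a ]) z → Match u z × z (length u) ≡ a
match-snoc⁻ [] (e , _) = tt , e
match-snoc⁻ (b ∷ u) (e , m) = let (mu , e') = match-snoc⁻ u m in (e , mu) , e'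

-- The competitor  cut x n c z = x₀ … x_{n-1} c z z z …  agrees with x before n, reads
-- c at n and the filler z afterwards.
cut : ∀ {A : Set} → (ℕ → A) → ℕ → A → A → ℕ → A
cut x zero c z zero = c
cut x zero c z (suc i) = z
cut x (suc n) c z zero = x zero
cut x (suc n) c z (suc i) = cut (λ j → x (suc j)) n c z i

cut-below : ∀ {A : Set} (x : ℕ → A) n c z i → i < n → cut x n c z i ≡ x i
cut-below x (suc n) c z zero _ = refl
cut-below x (suc n) c z (suc i) (s≤s i<n) = cut-below (λ j → x (suc j)) n c z i i<n

cut-at : ∀ {A : Set} (x : ℕ → A) n c z → cut x n c z n ≡ c
cut-at x zero c z = refl
cut-at x (suc n) c z = cut-at (λ j → x (suc j)) n c z

cut-above : ∀ {A : Set} (x : ℕ → A) n c z i → n < i → cut x n c z i ≡ z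
cut-above x zero c z (suc i) _ = refl
cut-above x (suc n) c z (suc i) (s≤s n<i) = cut-above (λ j → x (suc j)) n c z i n<i

cut-prefix : ∀ {q} (p : Word q) (x : InfWord q) n c z → length p ≤ n →
  PrefixOf p x → PrefixOf p (cut x n c z)
cut-prefix p x n c z le px = match⇒prefix p _
  (match-agree p (λ j j<p → sym (cut-below x n c z j (<-≤-trans j<p le))) (prefix⇒match p x px))

-- If x avoids g a and a differs from the filler z, an occurrence of g a in the
-- competitor must end exactly at n, i.e. g ends just before n in x and c = a.
cut-avoids : ∀ {q} (g : Word q) (a c z : Fin q) (x : InfWord q) n →
  ¬ FactorOfInf (g ++ [ a ]) x → a ≢ z →
  (∀ i → i + length g ≡ n → Match g (shift i x) → c ≢ a) →
  ¬ FactorOfInf (g ++ [ a ]) (cut x n c z)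
cut-avoids g a c z x n avoid a≢z no-end (i , occ) =
  by-position (<-cmp (i + length g) n) (match-snoc⁻ g (prefix⇒match (g ++ [ a ]) _ occ))
  where
  y : InfWord _
  y = cut x n c z
  unchanged : i + length g ≤ n → Agree (shift i y) (shift i x) (length g)
  unchanged le j j<g = cut-below x n c z (i + j) (<-≤-trans (+-monoʳ-< i j<g) le)
  by-position : Tri (i + length g < n) (i + length g ≡ n) (n < i + length g) →
    Match g (shift i y) × y (i + length g) ≡ a → ⊥
  by-position (tri< lt _ _) (mg , end) = avoid (i , match⇒prefix (g ++ [ a ]) _
    (match-snoc⁺ g (match-agree g (unchanged (<⇒≤ lt)) mg) (trans (sym (cut-below x n c z _ lt)) end)))
  by-position (tri≈ _ eq _) (mg , end) = no-end i eq (match-agree g (unchanged (≤-reflexive eq)) mg)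
    (trans (sym (cut-at x n c z)) (trans (cong y (sym eq)) end))
  by-position (tri> _ _ gt) (_ , end) = a≢z (trans (sym end) (cut-above x n c z _ gt))

competitor-above : ∀ {q} b (x : InfWord q) n c z → toℕ (x n) < toℕ c →
  (parity b x n ≡ true → x ⊏[ b ] cut x n c z) × (parity b x n ≡ false → cut x n c z ⊏[ b ] x)
competitor-above b x n c z lt = first-difference b x (cut x n c z) n
  (λ i i<n → sym (cut-below x n c z i i<n)) (subst (λ d → toℕ (x n) < toℕ d) (sym (cut-at x n c z)) lt)

competitor-below : ∀ {q} b (x : InfWord q) n c z → toℕ c < toℕ (x n) →
  (parity b x n ≡ true → cut x n c z ⊏[ b ] x) × (parity b x n ≡ false → x ⊏[ b ] cut x n c z)
competitor-below b x n c z lt =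
    (λ e → proj₁ compare (trans same-parity e)) , (λ e → proj₂ compare (trans same-parity e))
  where
  compare : (parity b (cut x n c z) n ≡ true → cut x n c z ⊏[ b ] x) ×
            (parity b (cut x n c z) n ≡ false → x ⊏[ b ] cut x n c z)
  compare = first-difference b (cut x n c z) x n (cut-below x n c z)
    (subst (λ d → toℕ d < toℕ (x n)) (sym (cut-at x n c z)) lt)
  same-parity : parity b (cut x n c z) n ≡ parity b x n
  same-parity = cong isEven (index-agree b _ x n (cut-below x n c z))

-- Membership in W_q is decidable: the only candidate exponent is |f| - 1.
InW? : ∀ q (f : Word q) → Dec (InW q f)
InW? q f with ≡-dec _≟_ (map toℕ f) (replicate (length f ∸ 1) (q ∸ 2) ++ [ q ∸ 1 ])
... | yes e = yes (_ , e)
... | no ne = no λ (ℓ , e) → ne (subst (λ k → map toℕ f ≡ replicate k (q ∸ 2) ++ [ q ∸ 1 ]) (exponent ℓ e) e)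
  where
  exponent : ∀ ℓ → map toℕ f ≡ replicate ℓ (q ∸ 2) ++ [ q ∸ 1 ] → ℓ ≡ length f ∸ 1
  exponent ℓ e = sym (begin
    length f ∸ 1                                          ≡⟨ cong (_∸ 1) (length-map toℕ f) ⟨
    length (map toℕ f) ∸ 1                                ≡⟨ cong (λ w → length w ∸ 1) e ⟩
    length (replicate ℓ (q ∸ 2) ++ [ q ∸ 1 ]) ∸ 1         ≡⟨ cong (_∸ 1) (length-++ (replicate ℓ (q ∸ 2))) ⟩
    length (replicate ℓ (q ∸ 2)) + 1 ∸ 1                  ≡⟨ m+n∸n≡m _ 1 ⟩
    length (replicate ℓ (q ∸ 2))                          ≡⟨ length-replicate ℓ ⟩
    ℓ                                                     ∎)

-- The alphabet A_q with q = r + 3, its letters q-2 (sub) and q-1 (top), and the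
-- effect of the letters 0, q-2, q-1 on the parity state in the appropriate order.
module Alphabet (r : ℕ) where

  Q : ℕ
  Q = suc (suc (suc r))

  β : Bool
  β = isEven Q

  sub top : Fin Q
  sub = inject₁ (fromℕ (suc r))
  top = fromℕ (suc (suc r))

  toℕ-sub : toℕ sub ≡ suc r
  toℕ-sub = trans (toℕ-inject₁ _) (toℕ-fromℕ _)

  toℕ-top : toℕ top ≡ suc (suc r)
  toℕ-top = toℕ-fromℕ _

  sub≢top : ∀ {c d : Fin Q} → toℕ c ≡ suc r → toℕ d ≡ suc (suc r) → c ≢ d
  sub≢top ec ed e = <-irrefl (trans (sym ec) (trans (cong toℕ e) ed)) (n<1+n (suc r))

  parity-after-0 : ∀ (x : InfWord Q) n → toℕ (x n) ≡ 0 → parity β x (suc n) ≡ parity β x n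
  parity-after-0 x n e = parity-keep β x n (trans (cong (isEven ∘ weight β) e) (cong isEven (weight-zero β)))

  parity-after-sub : ∀ (x : InfWord Q) n → toℕ (x n) ≡ suc r → parity β x (suc n) ≡ parity β x n
  parity-after-sub x n e = parity-keep β x n (trans (cong (isEven ∘ weight β) e) (weight-self (suc r)))

  parity-after-top : ∀ (x : InfWord Q) n → toℕ (x n) ≡ suc (suc r) → parity β x (suc n) ≡ not (parity β x n)
  parity-after-top x n e = parity-flip β x n (trans (cong (isEven ∘ weight β) e) (weight-succ (suc r)))

  letter≤top : ∀ (c : Fin Q) → toℕ c ≤ suc (suc r)
  letter≤top c = ≤-pred (toℕ<n c)

  module Witness (f : Word Q) (ℓ : ℕ) (f∈W : map toℕ f ≡ replicate ℓ (suc r) ++ [ suc (suc r) ]) where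

    f-shape : f ≡ replicate ℓ sub ++ [ top ]
    f-shape = map-injective toℕ-injective (begin
      map toℕ f                                  ≡⟨ f∈W ⟩
      replicate ℓ (suc r) ++ [ suc (suc r) ]     ≡⟨ cong₂ (λ s t → replicate ℓ s ++ [ t ]) toℕ-sub toℕ-top ⟨
      replicate ℓ (toℕ sub) ++ [ toℕ top ]       ≡⟨ cong (_++ [ toℕ top ]) (map-replicate toℕ ℓ sub) ⟨
      map toℕ (replicate ℓ sub) ++ [ toℕ top ]   ≡⟨ map-++ toℕ (replicate ℓ sub) [ top ] ⟨
      map toℕ (replicate ℓ sub ++ [ top ])       ∎)

    p : Word Q
    p = replicate ℓ sub

    constant : InfWord Q
    constant _ = sub

    constant-avoids : ¬ FactorOfInf f constant
    constant-avoids (i , occ) = sub≢top toℕ-sub toℕ-top (proj₂ (match-snoc⁻ p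
      (prefix⇒match (p ++ [ top ]) _ (subst (λ h → PrefixOf h (shift i constant)) f-shape occ))))

    -- every letter of p is q-2, whereas f contains q-1
    p-avoids : ¬ FactorOf f p
    p-avoids (u , v , e)
      with ++⁻ʳ p (subst (All (_≡ sub)) f-shape (++⁻ˡ f (++⁻ʳ u (subst (All (_≡ sub)) e (replicate⁺ ℓ refl)))))
    ... | top≡sub ∷ _ = sub≢top toℕ-sub toℕ-top (sym top≡sub)

    -- letters q-2 keep the (initially even) parity
    constant-parity : ∀ k → parity β constant k ≡ true
    constant-parity zero = cong isEven (index-zero β constant)
    constant-parity (suc k) = trans (parity-after-sub constant k toℕ-sub) (constant-parity k)

    -- a word agreeing with (q-2)^∞ before k ≥ ℓ and rising above it at k reads q-1
    -- there, completing (q-2)^ℓ (q-1)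
    rise-completes-f : ∀ y k → Agree constant y k → ℓ ≤ k → suc r < toℕ (y k) → FactorOfInf f y
    rise-completes-f y k ag ℓ≤k lt = k ∸ ℓ , subst (λ h → PrefixOf h (shift (k ∸ ℓ) y)) (sym f-shape)
      (match⇒prefix (p ++ [ top ]) _ (match-snoc⁺ p (match-replicate⁺ ℓ sub subs) at-k))
      where
      start+ℓ≡k : k ∸ ℓ + ℓ ≡ k
      start+ℓ≡k = m∸n+n≡m ℓ≤k
      subs : ∀ j → j < ℓ → y (k ∸ ℓ + j) ≡ sub
      subs j j<ℓ = sym (ag _ (subst (k ∸ ℓ + j <_) start+ℓ≡k (+-monoʳ-< (k ∸ ℓ) j<ℓ)))
      at-k : y (k ∸ ℓ + length p) ≡ top
      at-k = toℕ-injective (begin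
        toℕ (y (k ∸ ℓ + length p)) ≡⟨ cong (λ m → toℕ (y (k ∸ ℓ + m))) (length-replicate ℓ) ⟩
        toℕ (y (k ∸ ℓ + ℓ))        ≡⟨ cong (toℕ ∘ y) start+ℓ≡k ⟩
        toℕ (y k)                  ≡⟨ ≤-antisym (letter≤top (y k)) lt ⟩
        suc (suc r)                ≡⟨ toℕ-top ⟨
        toℕ top                    ∎)

    -- No word of p | A_q^∞(f) exceeds (q-2)^∞: it cannot differ inside p, and rising
    -- above q-2 in the even state means reading q-1 after (q-2)^ℓ.
    constant-last : IsLast Q f p constant
    constant-last = (match⇒prefix p constant (match-replicate⁺ ℓ sub (λ _ _ → refl)) , constant-avoids) , no-greater
      where
      no-greater : ∀ y → InPF f p y → ¬ AppLt Q constant y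
      no-greater y (py , y-avoids) lt with toOrder β lt
      ... | k , (ag , differ) , cmp with k <? ℓ
      ...   | yes k<ℓ = differ (sym (match-replicate⁻ ℓ sub (prefix⇒match p y py) k k<ℓ))
      ...   | no k≮ℓ with cmp
      ...     | inj₁ (_ , rise) = y-avoids (rise-completes-f y k ag (≮⇒≥ k≮ℓ) (subst (_< toℕ (y k)) toℕ-sub rise))
      ...     | inj₂ (odd , _) = 0≢1+n (trans (sym (even⇒%2≡0 (index β constant k) (constant-parity k))) odd)

    not-zero-periodic : ¬ InducesZeroPeriodicity Q f
    not-zero-periodic izp with proj₂ (izp p p-avoids) constant constant-last
    ... | N , zeros = 1+n≢0 (trans (sym toℕ-sub) (zeros N ≤-refl))

  module Forbidden (g : Word Q) (a : Fin Q) (toℕ-a : toℕ a ≡ suc (suc r)) where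

    f : Word Q
    f = g ++ [ a ]

    -- The last letter of f is not the filler 0, so competitors can only complete f at n.
    a≢0 : a ≢ fz
    a≢0 e = 1+n≢0 (trans (sym toℕ-a) (cong toℕ e))

    in-W : ∀ z → Match g z → (∀ j → j < length g → toℕ (z j) ≡ suc r) → InW Q f
    in-W z mg subs = length g , (begin
      map toℕ (g ++ [ a ])                                      ≡⟨ map-++ toℕ g [ a ] ⟩
      map toℕ g ++ [ toℕ a ]                                    ≡⟨ cong₂ (λ u d → map toℕ u ++ [ d ]) g-subs toℕ-a ⟩
      map toℕ (replicate (length g) sub) ++ [ suc (suc r) ]     ≡⟨ cong (_++ [ suc (suc r) ]) (map-replicate toℕ (length g) sub) ⟩
      replicate (length g) (toℕ sub) ++ [ suc (suc r) ]         ≡⟨ cong (λ d → replicate (length g) d ++ [ suc (suc r) ]) toℕ-sub ⟩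
      replicate (length g) (suc r) ++ [ suc (suc r) ]           ∎)
      where
      g-subs : g ≡ replicate (length g) sub
      g-subs = match-unique g _ mg
        (match-replicate⁺ (length g) sub (λ j j<g → toℕ-injective (trans (subs j j<g) (sym toℕ-sub))))
        (sym (length-replicate (length g)))

    Greedy : Word Q → Bool → InfWord Q → Set
    Greedy p w x = ∀ n c → InPF f p (cut x n c fz) →
      (parity β x n ≡ w → ¬ toℕ (x n) < toℕ c) × (parity β x n ≡ not w → ¬ toℕ c < toℕ (x n))

    -- A first word is greedy in the odd state: a competitor with a larger letter in the
    -- odd state, or a smaller one in the even state, would come before it.
    first-greedy : ∀ p x → IsFirst Q f p x → Greedy p false x
    first-greedy p x (_ , least) n c adm =
        (λ odd up → least _ adm (fromOrder β (proj₂ (competitor-above β x n c fz up) odd)))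
      , (λ even down → least _ adm (fromOrder β (proj₁ (competitor-below β x n c fz down) even)))

    -- Dually, a last word is greedy in the even state.
    last-greedy : ∀ p x → IsLast Q f p x → Greedy p true x
    last-greedy p x (_ , greatest) n c adm =
        (λ even up → greatest _ adm (fromOrder β (proj₁ (competitor-above β x n c fz up) even)))
      , (λ odd down → greatest _ adm (fromOrder β (proj₂ (competitor-below β x n c fz down) odd)))

    module Analysis (f∉W : ¬ InW Q f) (p : Word Q) (x : InfWord Q) (w : Bool)
                    (x∈ : InPF f p x) (greedy : Greedy p w x) where

      admissible : ∀ n c → length p ≤ n → (∀ i → i + length g ≡ n → Match g (shift i x) → c ≢ a) →
        InPF f p (cut x n c fz)
      admissible n c le no-end =
        cut-prefix p x n c fz le (proj₁ x∈) , cut-avoids g a c fz x n (proj₂ x∈) a≢0 no-end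

      -- In the state `not w` x is minimal, and 0 is admissible.
      zero-in-other-state : ∀ n → length p ≤ n → parity β x n ≡ not w → toℕ (x n) ≡ 0
      zero-in-other-state n le e =
        n≤0⇒n≡0 (≮⇒≥ (proj₂ (greedy n fz (admissible n fz le (λ _ _ _ → a≢0 ∘ sym))) e))

      Settled : Set
      Settled = ∃ λ m → length p ≤ m × parity β x m ≡ not w

      -- Once settled, x reads 0 forever, since 0 keeps the state.
      settled⇒ult : Settled → HasUltPeriod0 x
      settled⇒ult (m , le , e) = m , λ k m≤k → subst (λ i → toℕ (x i) ≡ 0) (m∸n+n≡m m≤k) (zero-from (k ∸ m))
        where
        after : ∀ d → length p ≤ d + m
        after d = ≤-trans le (m≤n+m m d)
        stays : ∀ d → parity β x (d + m) ≡ not w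
        stays zero = e
        stays (suc d) = trans (parity-after-0 x (d + m) (zero-in-other-state (d + m) (after d) (stays d))) (stays d)
        zero-from : ∀ d → toℕ (x (d + m)) ≡ 0
        zero-from d = zero-in-other-state (d + m) (after d) (stays d)

      -- In state w x is maximal, and q-2 is admissible: x reads q-2 or q-1.
      high-in-w-state : ∀ n → length p ≤ n → parity β x n ≡ w → toℕ (x n) ≡ suc r ⊎ toℕ (x n) ≡ suc (suc r)
      high-in-w-state n le e with toℕ (x n) ≟ suc r
      ... | yes is-sub = inj₁ is-sub
      ... | no not-sub = inj₂ (≤-antisym (letter≤top (x n)) (≤∧≢⇒< at-least-sub (not-sub ∘ sym)))
        where
        at-least-sub : suc r ≤ toℕ (x n)
        at-least-sub = subst (_≤ toℕ (x n)) toℕ-sub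
          (≮⇒≥ (proj₁ (greedy n sub (admissible n sub le (λ _ _ _ → sub≢top toℕ-sub toℕ-a))) e))

      sub-run : ∀ t n → length p ≤ n → parity β x n ≡ w →
        Settled ⊎ (parity β x (t + n) ≡ w × (∀ j → j < t → toℕ (x (j + n)) ≡ suc r))
      sub-run zero n le e = inj₂ (e , λ _ ())
      sub-run (suc t) n le e with high-in-w-state n le e
      ... | inj₂ is-top = inj₁ (suc n , m≤n⇒m≤1+n le , trans (parity-after-top x n is-top) (cong not e))
      ... | inj₁ is-sub with sub-run t (suc n) (m≤n⇒m≤1+n le) (trans (parity-after-sub x n is-sub) e)
      ...   | inj₁ settled = inj₁ settled
      ...   | inj₂ (e' , run) = inj₂ (subst (λ k → parity β x k ≡ w) (+-suc t n) e' , subs)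
        where
        subs : ∀ j → j < suc t → toℕ (x (j + n)) ≡ suc r
        subs zero _ = is-sub
        subs (suc j) (s≤s j<t) = subst (λ k → toℕ (x k) ≡ suc r) (+-suc j n) (run j j<t)

      -- After |g| letters q-2 from |p| on, q-1 would complete f = (q-2)^|g| (q-1) ∈ W_q;
      -- so q-1 is admissible and greater, and x must read it, which settles x.
      run-ends : parity β x (length g + length p) ≡ w →
        (∀ j → j < length g → toℕ (x (j + length p)) ≡ suc r) → Settled
      run-ends e run = by-letter (high-in-w-state m le e)
        where
        m : ℕ
        m = length g + length p
        le : length p ≤ m
        le = m≤n+m (length p) (length g)
        no-end : ∀ i → i + length g ≡ m → Match g (shift i x) → top ≢ a
        no-end i eq mg _ = f∉W (in-W (shift i x) mg λ j j<g →
          subst (λ k → toℕ (x k) ≡ suc r) (trans (+-comm j (length p)) (cong (_+ j) (sym i≡p))) (run j j<g))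
          where
          i≡p : i ≡ length p
          i≡p = +-cancelʳ-≡ (length g) i (length p) (trans eq (+-comm (length g) (length p)))
        by-letter : toℕ (x m) ≡ suc r ⊎ toℕ (x m) ≡ suc (suc r) → Settled
        by-letter (inj₂ is-top) = suc m , m≤n⇒m≤1+n le , trans (parity-after-top x m is-top) (cong not e)
        by-letter (inj₁ is-sub) = ⊥-elim (proj₁ (greedy m top (admissible m top le no-end)) e
          (subst₂ _<_ (sym is-sub) (sym toℕ-top) (n<1+n (suc r))))

      settles : Settled
      settles with bool-cases (parity β x (length p)) w
      ... | inj₂ e = length p , ≤-refl , e
      ... | inj₁ e with sub-run (length g) (length p) ≤-refl e
      ...   | inj₁ settled = settled
      ...   | inj₂ (e' , run) = run-ends e' run

      ultimately-zero : HasUltPeriod0 x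
      ultimately-zero = settled⇒ult settles

    induces-zero-periodicity : ¬ InW Q f → InducesZeroPeriodicity Q f
    induces-zero-periodicity f∉W p _ =
        (λ x first → Analysis.ultimately-zero f∉W p x false (proj₁ first) (first-greedy p x first))
      , (λ x last → Analysis.ultimately-zero f∉W p x true (proj₁ last) (last-greedy p x last))

theorem3 : (q : ℕ) → 3 ≤ q → (f : Word q) → LastIsTop q f →
    (¬ InducesZeroPeriodicity q f → InW q f) × (InW q f → ¬ InducesZeroPeriodicity q f)
theorem3 (suc (suc (suc r))) (s≤s (s≤s (s≤s z≤n))) .(g ++ [ a ]) (g , a , refl , toℕ-a) =
    (λ not-zp → decidable-stable (InW? _ f) (not-zp ∘ induces-zero-periodicity))
  , (λ (ℓ , f∈W) → Witness.not-zero-periodic f ℓ f∈W)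
  where
  open Alphabet r
  open Forbidden g a toℕ-a
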